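{- Let $q\ge2$ be an integer. Then the function $f:\mathbb{Z}_q^2\to\mathbb{Z}_{2q}$ defined by $$f(x_1,x_2)=2\hat{x}_1\hat{x}_2+\hat{x}_1 \pmod{2q}$$ is a $2q$-negabent function.
   Context: $\mathbb{Z}_m$ is the ring of integers modulo $m$. For $x\in\mathbb{Z}_q$, $\hat{x}\in\{0,\ldots,q-1\}$ is its least non-negative integer representative, and $\hat{\mathbf{x}}=(\hat{x}_1,\ldots,\hat{x}_n)$. Let $\xi$ be a primitive $q$-th root of unity and $\omega$ a primitive $2q$-th root of unity; $\langle\hat{\mathbf{x}},\hat{\mathbf{u}}\rangle=\sum_i\hat x_i\hat u_i$. The $2q$-nega-Hadamard transform of $f:\mathbb{Z}_q^n\to\mathbb{Z}_{2q}$ is $\mathcal{N}_f(\mathbf{u})=q^{ -n/2}\sum_{\mathbf{x}\in\mathbb{Z}_q^n}\omega^{f(\mathbf{x})}\xi^{\langle\hat{\mathbf{x}},\hat{\mathbf{u}}\rangle}\omega^{\sum_i\hat{x}_i}$, and $f$ is $2q$-negabent if $|\mathcal{N}_f(\mathbf{u})|=1$ for all $\mathbf{u}\in\mathbb{Z}_q^n$. -}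

module Defs where

open import Level using (Level)
open import Data.Nat using (ℕ; zero; suc; _+_; _*_; _∸_; _^_; _<_; NonZero)
open import Data.Nat.Properties using (m*n≢0)
open import Data.Nat.DivMod using (_mod_)
open import Data.Fin using (Fin; toℕ)
import Data.Fin
import Data.Sum
open import Data.Vec.Functional using (_∷_)
open import Data.Product using (_×_)
open import Relation.Nullary using (¬_)
open import Algebra.Bundles using (CommutativeRing)

-- Sum over Z_q^n (elements of Z_q^n are functions Fin n → Fin q;
-- the representative x̂ of x ∈ Z_q = Fin q is toℕ x).
sumℕ : (n : ℕ) → (Fin n → ℕ) → ℕ
sumℕ zero    g = 0
sumℕ (suc n) g = g Data.Fin.zero + sumℕ n (λ i → g (Data.Fin.suc i))

inner : {q n : ℕ} → (Fin n → Fin q) → (Fin n → Fin q) → ℕ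
inner {n = n} x u = sumℕ n (λ i → toℕ (x i) * toℕ (u i))

hatSum : {q n : ℕ} → (Fin n → Fin q) → ℕ
hatSum {n = n} x = sumℕ n (λ i → toℕ (x i))

module _ {c ℓ : Level} (R : CommutativeRing c ℓ) where
  open CommutativeRing R renaming (_+_ to _+ᴿ_; _*_ to _*ᴿ_)

  pow : Carrier → ℕ → Carrier
  pow a zero    = 1#
  pow a (suc k) = a *ᴿ pow a k

  fromℕ : ℕ → Carrier
  fromℕ zero    = 0#
  fromℕ (suc m) = 1# +ᴿ fromℕ m

  sumFin : (q : ℕ) → (Fin q → Carrier) → Carrier
  sumFin zero    g = 0#
  sumFin (suc q) g = g Data.Fin.zero +ᴿ sumFin q (λ i → g (Data.Fin.suc i))

  sumZqn : (q n : ℕ) → ((Fin n → Fin q) → Carrier) → Carrier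
  sumZqn q zero    g = g (λ ())
  sumZqn q (suc n) g = sumFin q (λ a → sumZqn q n (λ xs → g (a ∷ xs)))

  IsIntegralDomain : Set (c Level.⊔ ℓ)
  IsIntegralDomain = (¬ (1# ≈ 0#)) × (∀ a b → a *ᴿ b ≈ 0# → (a ≈ 0#) Data.Sum.⊎ (b ≈ 0#))

  IsPrimitiveRoot : Carrier → ℕ → Set ℓ
  IsPrimitiveRoot ζ m = (pow ζ m ≈ 1#) × (∀ k → 0 < k → k < m → ¬ (pow ζ k ≈ 1#))

  -- Unnormalised 2q-nega-Hadamard sum  q^{n/2} 𝒩_f(u)
  --   Σ_x ω^{f(x)} ξ^{⟨x̂,û⟩} ω^{Σ x̂ᵢ}
  negaSum : (q n : ℕ) → ((Fin n → Fin q) → Fin (2 * q)) →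
            Carrier → Carrier → (Fin n → Fin q) → Carrier
  negaSum q n f ω ξ u =
    sumZqn q n (λ x → pow ω (toℕ (f x)) *ᴿ pow ξ (inner x u) *ᴿ pow ω (hatSum x))

  -- f is 2q-negabent: |𝒩_f(u)|² = 1 for all u.  With complex conjugation
  -- realised as ω ↦ ω^{2q-1} = ω⁻¹, ξ ↦ ξ^{q-1} = ξ⁻¹, and after clearing
  -- the factor q^{-n}, this reads  S(ω,ξ,u) · S(ω⁻¹,ξ⁻¹,u) = q^n.
  IsNegabent : (q n : ℕ) → ((Fin n → Fin q) → Fin (2 * q)) → Set (c Level.⊔ ℓ)
  IsNegabent q n f =
    ∀ (ω ξ : Carrier) → IsPrimitiveRoot ω (2 * q) → IsPrimitiveRoot ξ q →
    ∀ (u : Fin n → Fin q) →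
    negaSum q n f ω ξ u *ᴿ negaSum q n f (pow ω (2 * q ∸ 1)) (pow ξ (q ∸ 1)) u
      ≈ fromℕ (q ^ n)

f₈ : (q : ℕ) .{{_ : NonZero q}} → (Fin 2 → Fin q) → Fin (2 * q)
f₈ q x = _mod_ (2 * toℕ (x Data.Fin.zero) * toℕ (x (Data.Fin.suc Data.Fin.zero))
                + toℕ (x Data.Fin.zero)) (2 * q) {{m*n≢0 2 q}}

{-# OPTIONS --safe #-}
module Submission where

-- Write X = x̂₁, Y = x̂₂ and û = (a, b).  Summing over X first, the nega-Hadamard sum
-- factorises as  S = Σ_Y c_Y G(W_Y)  with monomials c_Y = ω^Y ξ^{bY}, W_Y = ω^{2(Y+1)} ξ^a
-- and the geometric sum G(w) = Σ_{X<q} w^X.  Conjugation (ω, ξ) ↦ (ω⁻¹, ξ⁻¹) inverts c_Y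
-- and W_Y.  Each W_Y is a q-th root of unity, so W_Y fixes G(W_Y), and in an integral domain
-- an element fixed by some w ≠ 1 is 0.  Since W_j / W_i is a nontrivial power of ω², this
-- gives G(W_i) G(W_j⁻¹) = 0 for i ≠ j and = q G(W_i) for i = j.  Finally
-- Σ_Y G(W_Y) = Σ_X Σ_Y W_Y^X = q, because for 0 < X < q the inner sum is a multiple of
-- G(ω^{2X}) = 0.  Hence S S̄ = q · q.

open import Defs
open import Level using (Level)
open import Algebra.Bundles using (CommutativeRing)
open import Data.Nat.Base as ℕ using (ℕ; zero; suc; _≤_; _<_; _∸_; NonZero; z≤n; s≤s)
import Data.Nat.Properties as ℕₚ
open import Data.Nat.DivMod using (_%_; _/_; m≡m%n+[m/n]*n; m%n<n)
open import Data.Nat.Tactic.RingSolver using (solve-∀)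
open import Data.Fin.Base as Fin using (Fin; toℕ; punchIn)
open import Data.Fin.Properties using (toℕ-fromℕ<; toℕ<n; toℕ-injective; punchInᵢ≢i)
open import Data.Vec.Functional using (_∷_; removeAt; replicate)
open import Data.Product using (_,_; proj₁; proj₂)
open import Data.Sum using (inj₁; inj₂)
open import Function.Base using (_∘_)
import Relation.Binary.PropositionalEquality as ≡
open ≡ using (_≡_; _≢_)
open import Relation.Binary.Definitions using (tri<; tri≈; tri>)
open import Relation.Nullary using (¬_; contradiction)

module _ {r ℓ : Level} (R : CommutativeRing r ℓ) where
  open CommutativeRing R
  open import Algebra.Properties.Ring ring using (-1*x≈-x; x∙y⁻¹≈ε⇒x≈y; +-cancelʳ)
  open import Algebra.Properties.CommutativeSemigroup *-commutativeSemigroup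
    using (interchange; xy∙z≈xz∙y; x∙yz≈y∙xz)
  import Algebra.Properties.CommutativeSemigroup +-commutativeSemigroup as +-Semigroup
  open import Algebra.Properties.CommutativeSemiring.Exp commutativeSemiring
  open import Algebra.Properties.Semiring.Sum semiring
  open import Algebra.Properties.Semiring.Mult semiring using (_×_; ×-congʳ; ×-assoc-*; ×1-homo-*)
  open import Relation.Binary.Reasoning.Setoid setoid

  pow≡^ : ∀ x n → pow R x n ≡ x ^ n
  pow≡^ x zero    = ≡.refl
  pow≡^ x (suc n) = ≡.cong (x *_) (pow≡^ x n)

  fromℕ≡×1 : ∀ n → fromℕ R n ≡ n × 1#
  fromℕ≡×1 zero    = ≡.refl
  fromℕ≡×1 (suc n) = ≡.cong (1# +_) (fromℕ≡×1 n)

  sumFin≈sum : ∀ n {f g : Fin n → Carrier} → (∀ i → f i ≈ g i) → sumFin R n f ≈ sum g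
  sumFin≈sum zero    f≈g = refl
  sumFin≈sum (suc n) f≈g = +-cong (f≈g Fin.zero) (sumFin≈sum n (f≈g ∘ Fin.suc))

  1^n≈1 : ∀ n → 1# ^ n ≈ 1#
  1^n≈1 zero    = refl
  1^n≈1 (suc n) = trans (*-identityˡ _) (1^n≈1 n)

  x^n≈1⇒x^[n*k]≈1 : ∀ {x} n k → x ^ n ≈ 1# → x ^ (n ℕ.* k) ≈ 1#
  x^n≈1⇒x^[n*k]≈1 {x} n k x^n≈1 = begin
    x ^ (n ℕ.* k) ≈⟨ ^-assocʳ x n k ⟨
    (x ^ n) ^ k   ≈⟨ ^-congˡ k x^n≈1 ⟩
    1# ^ k        ≈⟨ 1^n≈1 k ⟩
    1#            ∎

  x^n≈1⇒x^[m%n]≈x^m : ∀ {x} n .{{_ : NonZero n}} m → x ^ n ≈ 1# → x ^ (m % n) ≈ x ^ m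
  x^n≈1⇒x^[m%n]≈x^m {x} n m x^n≈1 = sym (begin
    x ^ m                              ≡⟨ ≡.cong (x ^_) (m≡m%n+[m/n]*n m n) ⟩
    x ^ (m % n ℕ.+ m / n ℕ.* n)        ≈⟨ ^-homo-* x (m % n) _ ⟩
    x ^ (m % n) * x ^ (m / n ℕ.* n)    ≡⟨ ≡.cong (λ k → x ^ (m % n) * x ^ k) (ℕₚ.*-comm (m / n) n) ⟩
    x ^ (m % n) * x ^ (n ℕ.* (m / n))  ≈⟨ *-congˡ (x^n≈1⇒x^[n*k]≈1 n (m / n) x^n≈1) ⟩
    x ^ (m % n) * 1#                   ≈⟨ *-identityʳ _ ⟩
    x ^ (m % n)                        ∎)

  x*y≈1⇒x^n*y^n≈1 : ∀ {x y} → x * y ≈ 1# → ∀ n → x ^ n * y ^ n ≈ 1#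
  x*y≈1⇒x^n*y^n≈1 {x} {y} xy≈1 n = begin
    x ^ n * y ^ n ≈⟨ ^-distrib-* x y n ⟨
    (x * y) ^ n   ≈⟨ ^-congˡ n xy≈1 ⟩
    1# ^ n        ≈⟨ 1^n≈1 n ⟩
    1#            ∎

  x*y≈1∧x^n≈1⇒y^n≈1 : ∀ {x y} n → x * y ≈ 1# → x ^ n ≈ 1# → y ^ n ≈ 1#
  x*y≈1∧x^n≈1⇒y^n≈1 {x} {y} n xy≈1 x^n≈1 = begin
    y ^ n          ≈⟨ *-identityˡ _ ⟨
    1# * y ^ n     ≈⟨ *-congʳ x^n≈1 ⟨
    x ^ n * y ^ n  ≈⟨ x*y≈1⇒x^n*y^n≈1 xy≈1 n ⟩
    1#             ∎

  x*y≈1∧x*t≈t⇒y*t≈t : ∀ {x y t} → x * y ≈ 1# → x * t ≈ t → y * t ≈ t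
  x*y≈1∧x*t≈t⇒y*t≈t {x} {y} {t} xy≈1 xt≈t = begin
    y * t        ≈⟨ *-congˡ xt≈t ⟨
    y * (x * t)  ≈⟨ x∙yz≈y∙xz y x t ⟩
    x * (y * t)  ≈⟨ *-assoc x y t ⟨
    x * y * t    ≈⟨ *-congʳ xy≈1 ⟩
    1# * t       ≈⟨ *-identityˡ t ⟩
    t            ∎

  x*t≈t⇒x^k*t≈t : ∀ {x t} → x * t ≈ t → ∀ k → x ^ k * t ≈ t
  x*t≈t⇒x^k*t≈t xt≈t zero    = *-identityˡ _
  x*t≈t⇒x^k*t≈t xt≈t (suc k) =
    trans (*-assoc _ _ _) (trans (*-congˡ (x*t≈t⇒x^k*t≈t xt≈t k)) xt≈t)

  monomial : Carrier → Carrier → ℕ → ℕ → Carrier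
  monomial x y k l = x ^ k * y ^ l

  monomial-* : ∀ x y k l k′ l′ →
    monomial x y k l * monomial x y k′ l′ ≈ monomial x y (k ℕ.+ k′) (l ℕ.+ l′)
  monomial-* x y k l k′ l′ = begin
    (x ^ k * y ^ l) * (x ^ k′ * y ^ l′)  ≈⟨ interchange _ _ _ _ ⟩
    (x ^ k * x ^ k′) * (y ^ l * y ^ l′)  ≈⟨ *-cong (^-homo-* x k k′) (^-homo-* y l l′) ⟨
    x ^ (k ℕ.+ k′) * y ^ (l ℕ.+ l′)      ∎

  monomial-^ : ∀ x y k l n → monomial x y k l ^ n ≈ monomial x y (k ℕ.* n) (l ℕ.* n)
  monomial-^ x y k l n =
    trans (^-distrib-* (x ^ k) (y ^ l) n) (*-cong (^-assocʳ x k n) (^-assocʳ y l n))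

  monomial-shift : ∀ x y m k l → monomial x y (m ℕ.+ k) l ≈ x ^ m * monomial x y k l
  monomial-shift x y m k l = trans (*-congʳ (^-homo-* x m k)) (*-assoc _ _ _)

  monomial-inverse : ∀ {x x′ y y′} → x * x′ ≈ 1# → y * y′ ≈ 1# →
    ∀ k l → monomial x y k l * monomial x′ y′ k l ≈ 1#
  monomial-inverse {x} {x′} {y} {y′} xx′≈1 yy′≈1 k l = begin
    (x ^ k * y ^ l) * (x′ ^ k * y′ ^ l)
      ≈⟨ interchange _ _ _ _ ⟩
    (x ^ k * x′ ^ k) * (y ^ l * y′ ^ l)
      ≈⟨ *-cong (x*y≈1⇒x^n*y^n≈1 xx′≈1 k) (x*y≈1⇒x^n*y^n≈1 yy′≈1 l) ⟩
    1# * 1#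
      ≈⟨ *-identityˡ 1# ⟩
    1#
      ∎

  geometricSum : ℕ → Carrier → Carrier
  geometricSum n w = ∑[ i < n ] (w ^ toℕ i)

  geometricSum-suc : ∀ n w → geometricSum (suc n) w ≈ 1# + w * geometricSum n w
  geometricSum-suc n w = +-congˡ (sym (*-distribˡ-sum {n} w (λ i → w ^ toℕ i)))

  geometricSum-telescopes : ∀ n w → w * geometricSum n w + 1# ≈ geometricSum n w + w ^ n
  geometricSum-telescopes zero    w = +-congʳ (zeroʳ w)
  geometricSum-telescopes (suc n) w = begin
    w * geometricSum (suc n) w + 1#
      ≈⟨ +-congʳ (*-congˡ (trans (geometricSum-suc n w) (+-comm 1# _))) ⟩
    w * (w * G + 1#) + 1#
      ≈⟨ +-congʳ (*-congˡ (geometricSum-telescopes n w)) ⟩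
    w * (G + w ^ n) + 1#
      ≈⟨ +-congʳ (distribˡ w G (w ^ n)) ⟩
    (w * G + w ^ suc n) + 1#
      ≈⟨ +-Semigroup.xy∙z≈zx∙y _ _ _ ⟩
    (1# + w * G) + w ^ suc n
      ≈⟨ +-congʳ (geometricSum-suc n w) ⟨
    geometricSum (suc n) w + w ^ suc n
      ∎
    where G = geometricSum n w

  w^n≈1⇒w*G≈G : ∀ {w} n → w ^ n ≈ 1# → w * geometricSum n w ≈ geometricSum n w
  w^n≈1⇒w*G≈G {w} n w^n≈1 =
    +-cancelʳ 1# _ _ (trans (geometricSum-telescopes n w) (+-congˡ w^n≈1))

  w*t≈t⇒G*t≈n×t : ∀ {w t} n → w * t ≈ t → geometricSum n w * t ≈ n × 1# * t
  w*t≈t⇒G*t≈n×t {w} {t} n wt≈t = begin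
    geometricSum n w * t        ≈⟨ *-distribʳ-sum {n} t (λ i → w ^ toℕ i) ⟩
    ∑[ i < n ] (w ^ toℕ i * t)  ≈⟨ sum-cong-≋ {n} (λ i → x*t≈t⇒x^k*t≈t wt≈t (toℕ i)) ⟩
    sum (replicate n t)         ≈⟨ sum-replicate n ⟩
    n × t                       ≈⟨ ×-congʳ n (*-identityˡ t) ⟨
    n × (1# * t)                ≈⟨ ×-assoc-* n 1# t ⟨
    n × 1# * t                  ∎

  sum-zero-except : ∀ {n} (i : Fin (suc n)) (t : Fin (suc n) → Carrier) →
    (∀ j → j ≢ i → t j ≈ 0#) → sum t ≈ t i
  sum-zero-except {n} i t t≈0 = begin
    sum t
      ≈⟨ sum-remove {i = i} t ⟩
    t i + sum (removeAt t i)
      ≈⟨ +-congˡ (sum-cong-≋ (λ j → t≈0 (punchIn i j) (punchInᵢ≢i i j))) ⟩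
    t i + sum (replicate n 0#)
      ≈⟨ +-congˡ (sum-replicate-zero n) ⟩
    t i + 0#
      ≈⟨ +-identityʳ (t i) ⟩
    t i
      ∎

  sum*sum : ∀ {m n} (f : Fin m → Carrier) (g : Fin n → Carrier) →
    sum f * sum g ≈ ∑[ i < m ] ∑[ j < n ] (f i * g j)
  sum*sum f g = trans (*-distribʳ-sum (sum g) f) (sum-cong-≋ (λ i → *-distribˡ-sum (f i) g))

  module _ (domain : IsIntegralDomain R) where

    w≉1∧w*t≈t⇒t≈0 : ∀ {w t} → ¬ w ≈ 1# → w * t ≈ t → t ≈ 0#
    w≉1∧w*t≈t⇒t≈0 {w} {t} w≉1 wt≈t with proj₂ domain (w + - 1#) t [w-1]t≈0
      where
      [w-1]t≈0 : (w + - 1#) * t ≈ 0#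
      [w-1]t≈0 = begin
        (w + - 1#) * t     ≈⟨ distribʳ t w (- 1#) ⟩
        w * t + - 1# * t   ≈⟨ +-cong wt≈t (-1*x≈-x t) ⟩
        t + - t            ≈⟨ -‿inverseʳ t ⟩
        0#                 ∎
    ... | inj₁ w-1≈0 = contradiction (x∙y⁻¹≈ε⇒x≈y w 1# w-1≈0) w≉1
    ... | inj₂ t≈0   = t≈0

    geometricSum≈0 : ∀ {w} n → w ^ n ≈ 1# → ¬ w ≈ 1# → geometricSum n w ≈ 0#
    geometricSum≈0 n w^n≈1 w≉1 = w≉1∧w*t≈t⇒t≈0 w≉1 (w^n≈1⇒w*G≈G n w^n≈1)

  module NegaSum (q′ : ℕ) (u : Fin 2 → Fin (suc q′)) (Ω Ξ : Carrier) where
    q a b : ℕ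
    q = suc q′
    a = toℕ (u Fin.zero)
    b = toℕ (u (Fin.suc Fin.zero))

    c W : ℕ → Carrier
    c Y = monomial Ω Ξ Y (Y ℕ.* b)
    W Y = monomial Ω Ξ (2 ℕ.* suc Y) a

    W-shift : ∀ d Y → W (d ℕ.+ Y) ≈ Ω ^ (2 ℕ.* d) * W Y
    W-shift d Y = begin
      monomial Ω Ξ (2 ℕ.* suc (d ℕ.+ Y)) a   ≡⟨ ≡.cong (λ k → monomial Ω Ξ k a) (exponent d Y) ⟩
      monomial Ω Ξ (2 ℕ.* d ℕ.+ 2 ℕ.* suc Y) a ≈⟨ monomial-shift Ω Ξ (2 ℕ.* d) (2 ℕ.* suc Y) a ⟩
      Ω ^ (2 ℕ.* d) * W Y                    ∎
      where
      exponent : ∀ d Y → 2 ℕ.* suc (d ℕ.+ Y) ≡ 2 ℕ.* d ℕ.+ 2 ℕ.* suc Y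
      exponent = solve-∀

    W^q≈1 : Ω ^ (2 ℕ.* q) ≈ 1# → Ξ ^ q ≈ 1# → ∀ Y → W Y ^ q ≈ 1#
    W^q≈1 Ω^2q≈1 Ξ^q≈1 Y = begin
      W Y ^ q
        ≈⟨ monomial-^ Ω Ξ (2 ℕ.* suc Y) a q ⟩
      Ω ^ (2 ℕ.* suc Y ℕ.* q) * Ξ ^ (a ℕ.* q)
        ≡⟨ ≡.cong₂ (λ k l → Ω ^ k * Ξ ^ l) (exponent Y q) (ℕₚ.*-comm a q) ⟩
      Ω ^ (2 ℕ.* q ℕ.* suc Y) * Ξ ^ (q ℕ.* a)
        ≈⟨ *-cong (x^n≈1⇒x^[n*k]≈1 (2 ℕ.* q) (suc Y) Ω^2q≈1) (x^n≈1⇒x^[n*k]≈1 q a Ξ^q≈1) ⟩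
      1# * 1#
        ≈⟨ *-identityˡ 1# ⟩
      1#
        ∎
      where
      exponent : ∀ Y q → 2 ℕ.* suc Y ℕ.* q ≡ 2 ℕ.* q ℕ.* suc Y
      exponent = solve-∀

    negaSum-term : Ω ^ (2 ℕ.* q) ≈ 1# → ∀ x →
      pow R Ω (toℕ (f₈ q x)) * pow R Ξ (inner x u) * pow R Ω (hatSum x)
        ≈ c (toℕ (x (Fin.suc Fin.zero))) * W (toℕ (x (Fin.suc Fin.zero))) ^ toℕ (x Fin.zero)
    negaSum-term Ω^2q≈1 x = begin
      pow R Ω (toℕ (f₈ q x)) * pow R Ξ (inner x u) * pow R Ω (hatSum x)
        ≡⟨ ≡.cong₂ _*_ (≡.cong₂ _*_ (pow≡^ Ω (toℕ (f₈ q x))) (pow≡^ Ξ (inner x u)))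
                       (pow≡^ Ω (hatSum x)) ⟩
      Ω ^ toℕ (f₈ q x) * Ξ ^ B * Ω ^ C
        ≡⟨ ≡.cong (λ k → Ω ^ k * Ξ ^ B * Ω ^ C) (toℕ-fromℕ< (m%n<n A (2 ℕ.* q))) ⟩
      Ω ^ (A % (2 ℕ.* q)) * Ξ ^ B * Ω ^ C
        ≈⟨ *-congʳ (*-congʳ (x^n≈1⇒x^[m%n]≈x^m (2 ℕ.* q) A Ω^2q≈1)) ⟩
      Ω ^ A * Ξ ^ B * Ω ^ C
        ≈⟨ xy∙z≈xz∙y _ _ _ ⟩
      Ω ^ A * Ω ^ C * Ξ ^ B
        ≈⟨ *-congʳ (^-homo-* Ω A C) ⟨
      monomial Ω Ξ (A ℕ.+ C) B
        ≡⟨ ≡.cong₂ (monomial Ω Ξ) (Ω-exponent X Y) (Ξ-exponent X Y a b) ⟩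
      monomial Ω Ξ (Y ℕ.+ 2 ℕ.* suc Y ℕ.* X) (Y ℕ.* b ℕ.+ a ℕ.* X)
        ≈⟨ monomial-* Ω Ξ Y (Y ℕ.* b) (2 ℕ.* suc Y ℕ.* X) (a ℕ.* X) ⟨
      c Y * monomial Ω Ξ (2 ℕ.* suc Y ℕ.* X) (a ℕ.* X)
        ≈⟨ *-congˡ (monomial-^ Ω Ξ (2 ℕ.* suc Y) a X) ⟨
      c Y * W Y ^ X
        ∎
      where
      X Y A B C : ℕ
      X = toℕ (x Fin.zero)
      Y = toℕ (x (Fin.suc Fin.zero))
      A = 2 ℕ.* X ℕ.* Y ℕ.+ X
      B = X ℕ.* a ℕ.+ (Y ℕ.* b ℕ.+ 0)
      C = X ℕ.+ (Y ℕ.+ 0)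
      Ω-exponent : ∀ X Y → 2 ℕ.* X ℕ.* Y ℕ.+ X ℕ.+ (X ℕ.+ (Y ℕ.+ 0)) ≡ Y ℕ.+ 2 ℕ.* suc Y ℕ.* X
      Ω-exponent = solve-∀
      Ξ-exponent : ∀ X Y a b → X ℕ.* a ℕ.+ (Y ℕ.* b ℕ.+ 0) ≡ Y ℕ.* b ℕ.+ a ℕ.* X
      Ξ-exponent = solve-∀

    negaSum-factorises : Ω ^ (2 ℕ.* q) ≈ 1# →
      negaSum R q 2 (f₈ q) Ω Ξ u ≈ ∑[ j < q ] (c (toℕ j) * geometricSum q (W (toℕ j)))
    negaSum-factorises Ω^2q≈1 = begin
      negaSum R q 2 (f₈ q) Ω Ξ u
        ≈⟨ sumFin≈sum q (λ i → sumFin≈sum q (λ j → negaSum-term Ω^2q≈1 (i ∷ j ∷ λ ()))) ⟩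
      ∑[ i < q ] ∑[ j < q ] (c (toℕ j) * W (toℕ j) ^ toℕ i)
        ≈⟨ ∑-comm {q} {q} (λ i j → c (toℕ j) * W (toℕ j) ^ toℕ i) ⟩
      ∑[ j < q ] ∑[ i < q ] (c (toℕ j) * W (toℕ j) ^ toℕ i)
        ≈⟨ sum-cong-≋ {q} (λ j → *-distribˡ-sum {q} (c (toℕ j)) (λ i → W (toℕ j) ^ toℕ i)) ⟨
      ∑[ j < q ] (c (toℕ j) * geometricSum q (W (toℕ j)))
        ∎

  module Negabent (domain : IsIntegralDomain R) (q′ : ℕ) (u : Fin 2 → Fin (suc q′))
                  (ω ξ : Carrier) (ω-primitive : IsPrimitiveRoot R ω (2 ℕ.* suc q′))
                  (ξ-root : pow R ξ (suc q′) ≈ 1#) where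
    q : ℕ
    q = suc q′

    ω′ ξ′ : Carrier
    ω′ = pow R ω (2 ℕ.* q ∸ 1)
    ξ′ = pow R ξ (q ∸ 1)

    open NegaSum q′ u ω ξ using (a; b; c; W; W-shift; W^q≈1; negaSum-factorises)
    open NegaSum q′ u ω′ ξ′ using ()
      renaming (c to c′; W to W′; negaSum-factorises to negaSum′-factorises)

    ω^2q≈1 : ω ^ (2 ℕ.* q) ≈ 1#
    ω^2q≈1 = ≡.subst (_≈ 1#) (pow≡^ ω (2 ℕ.* q)) (proj₁ ω-primitive)

    ξ^q≈1 : ξ ^ q ≈ 1#
    ξ^q≈1 = ≡.subst (_≈ 1#) (pow≡^ ξ q) ξ-root

    -- As q is a successor, ω * ω′ and ξ * ξ′ unfold to pow R ω (2 * q) and pow R ξ q.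
    ωω′≈1 : ω * ω′ ≈ 1#
    ωω′≈1 = proj₁ ω-primitive

    ξξ′≈1 : ξ * ξ′ ≈ 1#
    ξξ′≈1 = ξ-root

    ω′^2q≈1 : ω′ ^ (2 ℕ.* q) ≈ 1#
    ω′^2q≈1 = x*y≈1∧x^n≈1⇒y^n≈1 (2 ℕ.* q) ωω′≈1 ω^2q≈1

    ω^[2k]≉1 : ∀ {k} → 0 < k → k < q → ¬ ω ^ (2 ℕ.* k) ≈ 1#
    ω^[2k]≉1 {k} 0<k k<q ω^2k≈1 =
      proj₂ ω-primitive (2 ℕ.* k) (ℕₚ.*-monoʳ-< 2 0<k) (ℕₚ.*-monoʳ-< 2 k<q)
        (≡.subst (_≈ 1#) (≡.sym (pow≡^ ω (2 ℕ.* k))) ω^2k≈1)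

    G G′ : ℕ → Carrier
    G Y = geometricSum q (W Y)
    G′ Y = geometricSum q (W′ Y)

    ∑W^k≈0 : ∀ {k} → 0 < k → k < q → ∑[ j < q ] (W (toℕ j) ^ k) ≈ 0#
    ∑W^k≈0 {k} 0<k k<q = begin
      ∑[ j < q ] (W (toℕ j) ^ k)
        ≈⟨ sum-cong-≋ {q} (λ j → W^k≈z^Y*W₀^k (toℕ j)) ⟩
      ∑[ j < q ] (z ^ toℕ j * W 0 ^ k)
        ≈⟨ *-distribʳ-sum {q} (W 0 ^ k) (λ j → z ^ toℕ j) ⟨
      geometricSum q z * W 0 ^ k
        ≈⟨ *-congʳ (geometricSum≈0 domain q z^q≈1 (ω^[2k]≉1 0<k k<q)) ⟩
      0# * W 0 ^ k
        ≈⟨ zeroˡ _ ⟩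
      0#
        ∎
      where
      z : Carrier
      z = ω ^ (2 ℕ.* k)

      exponent : ∀ m k → 2 ℕ.* m ℕ.* k ≡ 2 ℕ.* k ℕ.* m
      exponent = solve-∀

      z^q≈1 : z ^ q ≈ 1#
      z^q≈1 = begin
        z ^ q                ≈⟨ ^-assocʳ ω (2 ℕ.* k) q ⟩
        ω ^ (2 ℕ.* k ℕ.* q)  ≡⟨ ≡.cong (ω ^_) (exponent k q) ⟩
        ω ^ (2 ℕ.* q ℕ.* k)  ≈⟨ x^n≈1⇒x^[n*k]≈1 (2 ℕ.* q) k ω^2q≈1 ⟩
        1#                   ∎

      W^k≈z^Y*W₀^k : ∀ Y → W Y ^ k ≈ z ^ Y * W 0 ^ k
      W^k≈z^Y*W₀^k Y = begin
        W Y ^ k                        ≡⟨ ≡.cong (λ n → W n ^ k) (ℕₚ.+-identityʳ Y) ⟨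
        W (Y ℕ.+ 0) ^ k                ≈⟨ ^-congˡ k (W-shift Y 0) ⟩
        (ω ^ (2 ℕ.* Y) * W 0) ^ k      ≈⟨ ^-distrib-* _ _ k ⟩
        (ω ^ (2 ℕ.* Y)) ^ k * W 0 ^ k  ≈⟨ *-congʳ (^-assocʳ ω (2 ℕ.* Y) k) ⟩
        ω ^ (2 ℕ.* Y ℕ.* k) * W 0 ^ k  ≡⟨ ≡.cong (λ n → ω ^ n * W 0 ^ k) (exponent Y k) ⟩
        ω ^ (2 ℕ.* k ℕ.* Y) * W 0 ^ k  ≈⟨ *-congʳ (^-assocʳ ω (2 ℕ.* k) Y) ⟨
        z ^ Y * W 0 ^ k                ∎

    ∑G≈q : ∑[ j < q ] G (toℕ j) ≈ q × 1#
    ∑G≈q = begin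
      ∑[ j < q ] ∑[ i < q ] (W (toℕ j) ^ toℕ i)
        ≈⟨ ∑-comm {q} {q} (λ j i → W (toℕ j) ^ toℕ i) ⟩
      ∑[ i < q ] ∑[ j < q ] (W (toℕ j) ^ toℕ i)
        ≡⟨⟩
      sum (replicate q 1#) + ∑[ i < q′ ] ∑[ j < q ] (W (toℕ j) ^ suc (toℕ i))
        ≈⟨ +-cong (sum-replicate q) (sum-cong-≋ {q′} (λ i → ∑W^k≈0 (s≤s z≤n) (s≤s (toℕ<n i)))) ⟩
      q × 1# + sum (replicate q′ 0#)
        ≈⟨ +-congˡ (sum-replicate-zero q′) ⟩
      q × 1# + 0#
        ≈⟨ +-identityʳ _ ⟩
      q × 1#
        ∎

    W-separates-< : ∀ {Y₁ Y₂ t} → Y₁ < Y₂ → Y₂ < q →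
      W Y₁ * t ≈ t → W Y₂ * t ≈ t → t ≈ 0#
    W-separates-< {Y₁} {Y₂} {t} Y₁<Y₂ Y₂<q W₁t≈t W₂t≈t =
      w≉1∧w*t≈t⇒t≈0 domain (ω^[2k]≉1 0<d d<q) (begin
        ω ^ (2 ℕ.* d) * t             ≈⟨ *-congˡ W₁t≈t ⟨
        ω ^ (2 ℕ.* d) * (W Y₁ * t)    ≈⟨ *-assoc _ _ _ ⟨
        ω ^ (2 ℕ.* d) * W Y₁ * t      ≈⟨ *-congʳ (W-shift d Y₁) ⟨
        W (d ℕ.+ Y₁) * t              ≡⟨ ≡.cong (λ Y → W Y * t) (ℕₚ.m∸n+n≡m (ℕₚ.<⇒≤ Y₁<Y₂)) ⟩
        W Y₂ * t                      ≈⟨ W₂t≈t ⟩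
        t                             ∎)
      where
      d : ℕ
      d = Y₂ ∸ Y₁
      0<d : 0 < d
      0<d = ℕₚ.m<n⇒0<n∸m Y₁<Y₂
      d<q : d < q
      d<q = ℕₚ.≤-<-trans (ℕₚ.m∸n≤m Y₂ Y₁) Y₂<q

    W-separates : ∀ {i j : Fin q} {t} → i ≢ j →
      W (toℕ i) * t ≈ t → W (toℕ j) * t ≈ t → t ≈ 0#
    W-separates {i} {j} i≢j Wᵢt≈t Wⱼt≈t with ℕₚ.<-cmp (toℕ i) (toℕ j)
    ... | tri< i<j _ _ = W-separates-< i<j (toℕ<n j) Wᵢt≈t Wⱼt≈t
    ... | tri≈ _ i≡j _ = contradiction (toℕ-injective i≡j) i≢j
    ... | tri> _ _ j<i = W-separates-< j<i (toℕ<n i) Wⱼt≈t Wᵢt≈t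

    c*c′≈1 : ∀ Y → c Y * c′ Y ≈ 1#
    c*c′≈1 Y = monomial-inverse ωω′≈1 ξξ′≈1 Y (Y ℕ.* b)

    W*W′≈1 : ∀ Y → W Y * W′ Y ≈ 1#
    W*W′≈1 Y = monomial-inverse ωω′≈1 ξξ′≈1 (2 ℕ.* suc Y) a

    W*G≈G : ∀ Y → W Y * G Y ≈ G Y
    W*G≈G Y = w^n≈1⇒w*G≈G q (W^q≈1 ω^2q≈1 ξ^q≈1 Y)

    W′*G≈G : ∀ Y → W′ Y * G Y ≈ G Y
    W′*G≈G Y = x*y≈1∧x*t≈t⇒y*t≈t (W*W′≈1 Y) (W*G≈G Y)

    W*G′≈G′ : ∀ Y → W Y * G′ Y ≈ G′ Y
    W*G′≈G′ Y = x*y≈1∧x*t≈t⇒y*t≈t W′W≈1 (w^n≈1⇒w*G≈G q W′^q≈1)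
      where
      W′W≈1 : W′ Y * W Y ≈ 1#
      W′W≈1 = trans (*-comm _ _) (W*W′≈1 Y)
      W′^q≈1 : W′ Y ^ q ≈ 1#
      W′^q≈1 = x*y≈1∧x^n≈1⇒y^n≈1 q (W*W′≈1 Y) (W^q≈1 ω^2q≈1 ξ^q≈1 Y)

    G*G′-diagonal : ∀ Y → G Y * G′ Y ≈ q × 1# * G Y
    G*G′-diagonal Y = trans (*-comm _ _) (w*t≈t⇒G*t≈n×t q (W′*G≈G Y))

    G*G′-off-diagonal : ∀ {i j : Fin q} → i ≢ j → G (toℕ i) * G′ (toℕ j) ≈ 0#
    G*G′-off-diagonal {i} {j} i≢j = W-separates i≢j
      (trans (sym (*-assoc _ _ _)) (*-congʳ (W*G≈G (toℕ i))))
      (trans (x∙yz≈y∙xz _ _ _) (*-congˡ (W*G′≈G′ (toℕ j))))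

    negaSum*negaSum′≈q² :
      negaSum R q 2 (f₈ q) ω ξ u * negaSum R q 2 (f₈ q) ω′ ξ′ u ≈ fromℕ R (q ℕ.^ 2)
    negaSum*negaSum′≈q² = begin
      negaSum R q 2 (f₈ q) ω ξ u * negaSum R q 2 (f₈ q) ω′ ξ′ u
        ≈⟨ *-cong (negaSum-factorises ω^2q≈1) (negaSum′-factorises ω′^2q≈1) ⟩
      sum A * sum B
        ≈⟨ sum*sum A B ⟩
      ∑[ i < q ] ∑[ j < q ] (A i * B j)
        ≈⟨ sum-cong-≋ {q} (λ i → sum-zero-except i (λ j → A i * B j) (A*B-off-diagonal i)) ⟩
      ∑[ i < q ] (A i * B i)
        ≈⟨ sum-cong-≋ {q} A*B-diagonal ⟩
      ∑[ i < q ] (q × 1# * G (toℕ i))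
        ≈⟨ *-distribˡ-sum {q} (q × 1#) (λ i → G (toℕ i)) ⟨
      q × 1# * ∑[ i < q ] G (toℕ i)
        ≈⟨ *-congˡ ∑G≈q ⟩
      q × 1# * (q × 1#)
        ≈⟨ ×1-homo-* q q ⟨
      (q ℕ.* q) × 1#
        ≡⟨ ≡.cong (λ n → (q ℕ.* n) × 1#) (ℕₚ.*-identityʳ q) ⟨
      (q ℕ.^ 2) × 1#
        ≡⟨ fromℕ≡×1 (q ℕ.^ 2) ⟨
      fromℕ R (q ℕ.^ 2)
        ∎
      where
      A B : Fin q → Carrier
      A i = c (toℕ i) * G (toℕ i)
      B j = c′ (toℕ j) * G′ (toℕ j)

      A*B≈ : ∀ i j → A i * B j ≈ (c (toℕ i) * c′ (toℕ j)) * (G (toℕ i) * G′ (toℕ j))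
      A*B≈ i j = interchange _ _ _ _

      A*B-diagonal : ∀ i → A i * B i ≈ q × 1# * G (toℕ i)
      A*B-diagonal i = begin
        A i * B i                              ≈⟨ A*B≈ i i ⟩
        (c Y * c′ Y) * (G Y * G′ Y)            ≈⟨ *-congʳ (c*c′≈1 Y) ⟩
        1# * (G Y * G′ Y)                      ≈⟨ *-identityˡ _ ⟩
        G Y * G′ Y                             ≈⟨ G*G′-diagonal Y ⟩
        q × 1# * G Y                           ∎
        where Y = toℕ i

      A*B-off-diagonal : ∀ i j → j ≢ i → A i * B j ≈ 0#
      A*B-off-diagonal i j j≢i = begin
        A i * B j                                ≈⟨ A*B≈ i j ⟩
        (c Yᵢ * c′ Yⱼ) * (G Yᵢ * G′ Yⱼ)          ≈⟨ *-congˡ (G*G′-off-diagonal (≡.≢-sym j≢i)) ⟩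
        (c Yᵢ * c′ Yⱼ) * 0#                      ≈⟨ zeroʳ _ ⟩
        0#                                       ∎
        where Yᵢ = toℕ i
              Yⱼ = toℕ j

theorem8 : (q : ℕ) .{{_ : NonZero q}} → 2 ≤ q →
    ∀ {c ℓ : Level} (R : CommutativeRing c ℓ) → IsIntegralDomain R →
    IsNegabent R q 2 (f₈ q)
theorem8 (suc q′) _ R domain ω ξ ω-primitive (ξ-root , _) u =
  Negabent.negaSum*negaSum′≈q² R domain q′ u ω ξ ω-primitive ξ-root
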